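{- Let $(X,\wedge,\vee,\bot,\top)$ be a bounded distributive lattice, let $n\ge 1$, and let $x=(x_1,\ldots,x_n)$ be a sequence in $X$. For $0\le m\le n$ and $0\le k\le m+1$ define \[ S_x(m,k)=\begin{cases}\bot & k=0,\\[2pt] \displaystyle\bigwedge_{I\subseteq\{1,\ldots,m\},\ |I|=k}\ \bigvee_{i\in I} x_i & 1\le k\le m,\\[2pt] \top & k=m+1.\end{cases} \] Then for every $k$ with $1\le k\le n$, \[ S_x(n,k)=S_x(n-1,k)\wedge\bigl(S_x(n-1,k-1)\vee x_n\bigr). \]
   Context: $\bot$ and $\top$ denote the least and greatest elements of $X$. For $1\le k\le m$, $S_x(m,k)$ is the $k$-th entry of the sequence $(x_1,\ldots,x_m)$ "sorted with respect to the lattice", defined by the displayed meet over all $k$-element subsets $I$ of $\{1,\ldots,m\}$ of the joins $\bigvee_{i\in I}x_i$. The boundary values $S_x(m,0)=\bot$ and $S_x(m,m+1)=\top$ are conventions. -}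

module Defs where

open import Level using (Level; _⊔_) renaming (suc to lsuc)
open import Data.Nat using (ℕ; zero; suc; _≤_; _<_; _≟_)
open import Data.Bool using (Bool; true; false)
open import Data.Fin using (Fin; inject≤)
open import Data.Vec using (Vec; []; _∷_)
open import Data.List using (List; []; _∷_; _++_; map; filter)
open import Data.Fin.Subset using (Subset; ∣_∣)
open import Relation.Binary.PropositionalEquality using (_≡_)
open import Relation.Nullary using (yes; no)
open import Algebra.Lattice.Bundles using (DistributiveLattice)

record BoundedDistributiveLattice (c ℓ : Level) : Set (lsuc (c ⊔ ℓ)) where
  field
    distributiveLattice : DistributiveLattice c ℓ
  open DistributiveLattice distributiveLattice public
  field
    ⊥ : Carrier
    ⊤ : Carrier
    ⊥-least    : ∀ x → (⊥ ∧ x) ≈ ⊥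
    ⊤-greatest : ∀ x → (⊤ ∨ x) ≈ ⊤

allSubsets : (m : ℕ) → List (Subset m)
allSubsets zero    = [] ∷ []
allSubsets (suc m) = map (true ∷_) (allSubsets m) ++ map (false ∷_) (allSubsets m)

subsetsOfSize : (m k : ℕ) → List (Subset m)
subsetsOfSize m k = filter (λ p → ∣ p ∣ ≟ k) (allSubsets m)

module _ {c ℓ} (L : BoundedDistributiveLattice c ℓ) where
  open BoundedDistributiveLattice L

  bigJoin : ∀ {m} → (Fin m → Carrier) → Subset m → Carrier
  bigJoin {zero}  y []          = ⊥
  bigJoin {suc m} y (true ∷ p)  = y Fin.zero ∨ bigJoin (λ i → y (Fin.suc i)) p
    where import Data.Fin as Fin
  bigJoin {suc m} y (false ∷ p) = bigJoin (λ i → y (Fin.suc i)) p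
    where import Data.Fin as Fin

  bigMeet : List Carrier → Carrier
  bigMeet []       = ⊤
  bigMeet (a ∷ as) = a ∧ bigMeet as

  -- S_x(m,k) for a sequence x = (x_1,…,x_n), 0 ≤ m ≤ n (indices shifted to Fin n).
  -- k = 0 ↦ ⊥, k = m+1 ↦ ⊤, otherwise (1 ≤ k ≤ m) ↦ ⋀_{|I|=k} ⋁_{i∈I} x_i.
  -- (Values for k > m+1 are never used.)
  S : ∀ {n} → (Fin n → Carrier) → (m : ℕ) → m ≤ n → ℕ → Carrier
  S x m m≤n zero    = ⊥
  S x m m≤n (suc k) with k ≟ m
  ... | yes _ = ⊤
  ... | no  _ =
    bigMeet (map (bigJoin (λ i → x (inject≤ i m≤n))) (subsetsOfSize m (suc k)))

-- Write the recurrence as an operator on sequences, adjoin s z k = s k ∧ (s (k-1) ∨ z),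
-- and let T_y(k) be the meet over k-subsets of the joins of y (meetOfJoins below; it is ⊥
-- at k = 0 and ⊤ beyond the length of y, so it agrees with S). Splitting the k-subsets of
-- y₁ … yₘ₊₁ according to whether they contain y₁ and distributing ∨ over ∧ gives
-- T_y = adjoin T_{tail y} y₁. Adjoining two elements in either order gives the same
-- sequence (a distributive-lattice identity), so induction on the length moves the
-- adjoined element from the front to the back: T_y = adjoin T_{init y} yₘ₊₁.
module Submission where

open import Defs
open import Data.Nat using (ℕ; zero; suc; _≤_; _<_; _≟_; pred)
open import Data.Nat.Properties using (≤-refl; n≤1+n; n<1+n; suc-injective; <⇒≢; ≤-<-trans)
open import Data.Fin using (Fin; fromℕ; inject≤; inject₁)
open import Data.Fin.Properties using (inject≤-refl)
open import Data.Fin.Subset using (Subset; ∣_∣)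
open import Data.Fin.Subset.Properties using (∣p∣≤n)
open import Data.Vec using ([]; _∷_)
open import Data.Vec.Functional using (head; tail; init; last)
open import Data.Bool using (true; false)
open import Data.List using (List; []; _∷_; _++_; map; filter)
open import Data.List.Properties using (filter-++; filter-≐; filter-none; map-++; map-∘; map-cong)
open import Data.List.Relation.Unary.All using (tabulate)
open import Data.Product using (_,_)
open import Function using (_∘_)
open import Relation.Nullary using (does; yes; no)
open import Relation.Unary using (Pred; Decidable)
open import Relation.Binary.PropositionalEquality as ≡
  using (_≡_; _≗_; cong; cong₂)
open import Algebra.Lattice.Bundles using (DistributiveLattice)

filter-map : ∀ {a b p} {A : Set a} {B : Set b} {P : Pred B p} (P? : Decidable P)
             (f : A → B) (xs : List A) →
             filter P? (map f xs) ≡ map f (filter (P? ∘ f) xs)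
filter-map P? f []       = ≡.refl
filter-map P? f (x ∷ xs) with does (P? (f x))
... | true  = cong (f x ∷_) (filter-map P? f xs)
... | false = filter-map P? f xs

inject≤≗inject₁ : ∀ {n} (i : Fin n) .(n≤1+n : n ≤ suc n) → inject≤ i n≤1+n ≡ inject₁ i
inject≤≗inject₁ Fin.zero    _ = ≡.refl
inject≤≗inject₁ (Fin.suc i) _ = cong Fin.suc (inject≤≗inject₁ i _)

hasSize? : ∀ {m} k → Decidable (λ (p : Subset m) → ∣ p ∣ ≡ k)
hasSize? k p = ∣ p ∣ ≟ k

subsetsOfSize-suc-zero : ∀ m → subsetsOfSize (suc m) 0 ≡ map (false ∷_) (subsetsOfSize m 0)
subsetsOfSize-suc-zero m = begin
  filter (hasSize? 0) (map (true ∷_) ps ++ map (false ∷_) ps)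
    ≡⟨ filter-++ (hasSize? 0) (map (true ∷_) ps) _ ⟩
  filter (hasSize? 0) (map (true ∷_) ps) ++ filter (hasSize? 0) (map (false ∷_) ps)
    ≡⟨ cong₂ _++_ (filter-map (hasSize? 0) (true ∷_) ps) (filter-map (hasSize? 0) (false ∷_) ps) ⟩
  map (true ∷_) (filter (hasSize? 0 ∘ (true ∷_)) ps) ++ map (false ∷_) (subsetsOfSize m 0)
    ≡⟨ cong (λ qs → map (true ∷_) qs ++ map (false ∷_) (subsetsOfSize m 0))
            (filter-none (hasSize? 0 ∘ (true ∷_)) (tabulate {xs = ps} λ _ ())) ⟩
  map (false ∷_) (subsetsOfSize m 0) ∎
  where
    open ≡.≡-Reasoning
    ps = allSubsets m

subsetsOfSize-suc-suc : ∀ m k → subsetsOfSize (suc m) (suc k) ≡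
  map (true ∷_) (subsetsOfSize m k) ++ map (false ∷_) (subsetsOfSize m (suc k))
subsetsOfSize-suc-suc m k = begin
  filter (hasSize? (suc k)) (map (true ∷_) ps ++ map (false ∷_) ps)
    ≡⟨ filter-++ (hasSize? (suc k)) (map (true ∷_) ps) _ ⟩
  filter (hasSize? (suc k)) (map (true ∷_) ps) ++ filter (hasSize? (suc k)) (map (false ∷_) ps)
    ≡⟨ cong₂ _++_ (filter-map (hasSize? (suc k)) (true ∷_) ps) (filter-map (hasSize? (suc k)) (false ∷_) ps) ⟩
  map (true ∷_) (filter (hasSize? (suc k) ∘ (true ∷_)) ps) ++ map (false ∷_) (subsetsOfSize m (suc k))
    ≡⟨ cong (λ qs → map (true ∷_) qs ++ map (false ∷_) (subsetsOfSize m (suc k)))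
            (filter-≐ (hasSize? (suc k) ∘ (true ∷_)) (hasSize? k) (suc-injective , cong suc) ps) ⟩
  map (true ∷_) (subsetsOfSize m k) ++ map (false ∷_) (subsetsOfSize m (suc k)) ∎
  where
    open ≡.≡-Reasoning
    ps = allSubsets m

subsetsOfSize-> : ∀ {m k} → m < k → subsetsOfSize m k ≡ []
subsetsOfSize-> {m} {k} m<k =
  filter-none (hasSize? k) (tabulate {xs = allSubsets m} λ {p} _ → <⇒≢ (≤-<-trans (∣p∣≤n p) m<k))

module Adjoin {ℓ₁ ℓ₂} (D : DistributiveLattice ℓ₁ ℓ₂) where
  open DistributiveLattice D
  open import Relation.Binary.Reasoning.Setoid setoid

  adjoin : (ℕ → Carrier) → Carrier → ℕ → Carrier
  adjoin s z k = s k ∧ (s (pred k) ∨ z)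

  adjoin-cong : ∀ {s t} → (∀ k → s k ≈ t k) → ∀ z k → adjoin s z k ≈ adjoin t z k
  adjoin-cong s≈t z k = ∧-cong (s≈t k) (∨-congʳ (s≈t (pred k)))

  private
    ∧-exchangeˡ : ∀ a b c → (a ∧ (b ∧ c)) ≈ (b ∧ (a ∧ c))
    ∧-exchangeˡ a b c = begin
      a ∧ (b ∧ c) ≈⟨ ∧-assoc a b c ⟨
      (a ∧ b) ∧ c ≈⟨ ∧-congʳ (∧-comm a b) ⟩
      (b ∧ a) ∧ c ≈⟨ ∧-assoc b a c ⟩
      b ∧ (a ∧ c) ∎

    ∨-distribʳ-adjoin : ∀ b c z w → ((b ∧ (c ∨ z)) ∨ w) ≈ ((b ∨ w) ∧ (c ∨ (z ∨ w)))
    ∨-distribʳ-adjoin b c z w = trans (∨-distribʳ-∧ w b (c ∨ z)) (∧-congˡ (∨-assoc c z w))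

  adjoin-comm : ∀ s z w k → adjoin (adjoin s z) w k ≈ adjoin (adjoin s w) z k
  adjoin-comm s z w k = begin
    (a ∧ (b ∨ z)) ∧ ((b ∧ (c ∨ z)) ∨ w)        ≈⟨ ∧-congˡ (∨-distribʳ-adjoin b c z w) ⟩
    (a ∧ (b ∨ z)) ∧ ((b ∨ w) ∧ (c ∨ (z ∨ w)))  ≈⟨ ∧-assoc a _ _ ⟩
    a ∧ ((b ∨ z) ∧ ((b ∨ w) ∧ (c ∨ (z ∨ w))))  ≈⟨ ∧-congˡ (∧-exchangeˡ _ _ _) ⟩
    a ∧ ((b ∨ w) ∧ ((b ∨ z) ∧ (c ∨ (z ∨ w))))  ≈⟨ ∧-congˡ (∧-congˡ (∧-congˡ (∨-congˡ (∨-comm z w)))) ⟩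
    a ∧ ((b ∨ w) ∧ ((b ∨ z) ∧ (c ∨ (w ∨ z))))  ≈⟨ ∧-assoc a _ _ ⟨
    (a ∧ (b ∨ w)) ∧ ((b ∨ z) ∧ (c ∨ (w ∨ z)))  ≈⟨ ∧-congˡ (∨-distribʳ-adjoin b c w z) ⟨
    (a ∧ (b ∨ w)) ∧ ((b ∧ (c ∨ w)) ∨ z)        ∎
    where
      a = s k
      b = s (pred k)
      c = s (pred (pred k))

module _ {c ℓ} (L : BoundedDistributiveLattice c ℓ) where
  open BoundedDistributiveLattice L
  open Adjoin distributiveLattice
  open import Relation.Binary.Reasoning.Setoid setoid

  meetOfJoins : (m : ℕ) → (Fin m → Carrier) → ℕ → Carrier
  meetOfJoins m y k = bigMeet L (map (bigJoin L y) (subsetsOfSize m k))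

  ∨-zeroʳ : ∀ a → (a ∨ ⊤) ≈ ⊤
  ∨-zeroʳ a = trans (∨-comm a ⊤) (⊤-greatest a)

  ∧-identityˡ : ∀ a → (⊤ ∧ a) ≈ a
  ∧-identityˡ a = begin
    ⊤ ∧ a       ≈⟨ ∧-comm ⊤ a ⟩
    a ∧ ⊤       ≈⟨ ∧-congˡ (∨-zeroʳ a) ⟨
    a ∧ (a ∨ ⊤) ≈⟨ ∧-absorbs-∨ a ⊤ ⟩
    a           ∎

  bigMeet-++ : ∀ xs ys → bigMeet L (xs ++ ys) ≈ (bigMeet L xs ∧ bigMeet L ys)
  bigMeet-++ []       ys = sym (∧-identityˡ (bigMeet L ys))
  bigMeet-++ (x ∷ xs) ys = trans (∧-congˡ (bigMeet-++ xs ys)) (sym (∧-assoc x _ _))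

  ∨-distribˡ-bigMeet : ∀ a xs → (a ∨ bigMeet L xs) ≈ bigMeet L (map (a ∨_) xs)
  ∨-distribˡ-bigMeet a []       = ∨-zeroʳ a
  ∨-distribˡ-bigMeet a (x ∷ xs) = trans (∨-distribˡ-∧ a x _) (∧-congˡ (∨-distribˡ-bigMeet a xs))

  bigJoin-cong : ∀ {m} {y y′ : Fin m → Carrier} → y ≗ y′ → bigJoin L y ≗ bigJoin L y′
  bigJoin-cong {zero}  y≗y′ []          = ≡.refl
  bigJoin-cong {suc m} y≗y′ (true ∷ p)  = cong₂ _∨_ (y≗y′ Fin.zero) (bigJoin-cong (y≗y′ ∘ Fin.suc) p)
  bigJoin-cong {suc m} y≗y′ (false ∷ p) = bigJoin-cong (y≗y′ ∘ Fin.suc) p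

  meetOfJoins-cong : ∀ {m} {y y′ : Fin m → Carrier} → y ≗ y′ → meetOfJoins m y ≗ meetOfJoins m y′
  meetOfJoins-cong {m} y≗y′ k = cong (bigMeet L) (map-cong (bigJoin-cong y≗y′) (subsetsOfSize m k))

  meetOfJoins-suc-zero : ∀ m (y : Fin (suc m) → Carrier) → meetOfJoins (suc m) y 0 ≡ meetOfJoins m (tail y) 0
  meetOfJoins-suc-zero m y = ≡.trans
    (cong (bigMeet L ∘ map (bigJoin L y)) (subsetsOfSize-suc-zero m))
    (cong (bigMeet L) (≡.sym (map-∘ (subsetsOfSize m 0))))

  meetOfJoins-zero : ∀ m (y : Fin m → Carrier) → meetOfJoins m y 0 ≈ ⊥
  meetOfJoins-zero zero    y = ⊥-least ⊤
  meetOfJoins-zero (suc m) y = trans (reflexive (meetOfJoins-suc-zero m y)) (meetOfJoins-zero m (tail y))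

  meetOfJoins-> : ∀ m (y : Fin m → Carrier) {k} → m < k → meetOfJoins m y k ≈ ⊤
  meetOfJoins-> m y m<k = reflexive (cong (bigMeet L ∘ map (bigJoin L y)) (subsetsOfSize-> m<k))

  meetOfJoins-adjoin-head : ∀ m (y : Fin (suc m) → Carrier) k →
    meetOfJoins (suc m) y k ≈ adjoin (meetOfJoins m (tail y)) (head y) k
  meetOfJoins-adjoin-head m y zero = begin
    meetOfJoins (suc m) y 0            ≡⟨ meetOfJoins-suc-zero m y ⟩
    T 0                                ≈⟨ ∧-absorbs-∨ (T 0) (head y) ⟨
    T 0 ∧ (T 0 ∨ head y)               ∎
    where T = meetOfJoins m (tail y)
  meetOfJoins-adjoin-head m y (suc k) = begin
    meetOfJoins (suc m) y (suc k)
      ≡⟨ cong (bigMeet L ∘ map (bigJoin L y)) (subsetsOfSize-suc-suc m k) ⟩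
    bigMeet L (map (bigJoin L y) (map (true ∷_) P ++ map (false ∷_) Q))
      ≡⟨ cong (bigMeet L) (map-++ (bigJoin L y) (map (true ∷_) P) (map (false ∷_) Q)) ⟩
    bigMeet L (map (bigJoin L y) (map (true ∷_) P) ++ map (bigJoin L y) (map (false ∷_) Q))
      ≡⟨ cong₂ (λ as bs → bigMeet L (as ++ bs)) containing-head avoiding-head ⟩
    bigMeet L (map (head y ∨_) (map J P) ++ map J Q)
      ≈⟨ bigMeet-++ (map (head y ∨_) (map J P)) (map J Q) ⟩
    bigMeet L (map (head y ∨_) (map J P)) ∧ T (suc k)
      ≈⟨ ∧-congʳ (∨-distribˡ-bigMeet (head y) (map J P)) ⟨
    (head y ∨ T k) ∧ T (suc k)
      ≈⟨ ∧-comm _ _ ⟩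
    T (suc k) ∧ (head y ∨ T k)
      ≈⟨ ∧-congˡ (∨-comm (head y) (T k)) ⟩
    T (suc k) ∧ (T k ∨ head y) ∎
    where
      T = meetOfJoins m (tail y)
      J = bigJoin L (tail y)
      P = subsetsOfSize m k
      Q = subsetsOfSize m (suc k)
      containing-head : map (bigJoin L y) (map (true ∷_) P) ≡ map (head y ∨_) (map J P)
      containing-head = ≡.trans (≡.sym (map-∘ P)) (map-∘ P)
      avoiding-head : map (bigJoin L y) (map (false ∷_) Q) ≡ map J Q
      avoiding-head = ≡.sym (map-∘ Q)

  meetOfJoins-adjoin-last : ∀ m (y : Fin (suc m) → Carrier) k →
    meetOfJoins (suc m) y k ≈ adjoin (meetOfJoins m (init y)) (last y) k
  meetOfJoins-adjoin-last zero y k = trans (meetOfJoins-adjoin-head zero y k)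
    (adjoin-cong (λ j → reflexive (meetOfJoins-cong {y = tail y} {init y} (λ ()) j)) (head y) k)
  meetOfJoins-adjoin-last (suc m) y k = begin
    meetOfJoins (suc (suc m)) y k
      ≈⟨ meetOfJoins-adjoin-head (suc m) y k ⟩
    adjoin (meetOfJoins (suc m) (tail y)) (head y) k
      ≈⟨ adjoin-cong (meetOfJoins-adjoin-last m (tail y)) (head y) k ⟩
    adjoin (adjoin T (last y)) (head y) k
      ≈⟨ adjoin-comm T (last y) (head y) k ⟩
    adjoin (adjoin T (head y)) (last y) k
      ≈⟨ adjoin-cong (meetOfJoins-adjoin-head m (init y)) (last y) k ⟨
    adjoin (meetOfJoins (suc m) (init y)) (last y) k ∎
    where T = meetOfJoins m (tail (init y))

  S≈meetOfJoins : ∀ {n} (x : Fin n → Carrier) m (m≤n : m ≤ n) k →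
    S L x m m≤n k ≈ meetOfJoins m (λ i → x (inject≤ i m≤n)) k
  S≈meetOfJoins x m m≤n zero = sym (meetOfJoins-zero m _)
  S≈meetOfJoins x m m≤n (suc k) with k ≟ m
  ... | yes ≡.refl = sym (meetOfJoins-> m _ (n<1+n m))
  ... | no _       = refl

  S-adjoin-last : ∀ n (x : Fin (suc n) → Carrier) k →
    S L x (suc n) ≤-refl k ≈ adjoin (S L x n (n≤1+n n)) (last x) k
  S-adjoin-last n x k = begin
    S L x (suc n) ≤-refl k
      ≈⟨ S≈meetOfJoins x (suc n) ≤-refl k ⟩
    meetOfJoins (suc n) (λ i → x (inject≤ i ≤-refl)) k
      ≡⟨ meetOfJoins-cong (λ i → cong x (inject≤-refl i _)) k ⟩
    meetOfJoins (suc n) x k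
      ≈⟨ meetOfJoins-adjoin-last n x k ⟩
    adjoin (meetOfJoins n (init x)) (last x) k
      ≈⟨ adjoin-cong S≈meetOfJoins-init (last x) k ⟨
    adjoin (S L x n (n≤1+n n)) (last x) k ∎
    where
      S≈meetOfJoins-init : ∀ j → S L x n (n≤1+n n) j ≈ meetOfJoins n (init x) j
      S≈meetOfJoins-init j = trans (S≈meetOfJoins x n (n≤1+n n) j)
        (reflexive (meetOfJoins-cong (λ i → cong x (inject≤≗inject₁ i _)) j))

proposition3p1 : ∀ {c ℓ} (L : BoundedDistributiveLattice c ℓ) (n : ℕ) (x : Data.Fin.Fin (suc n) → BoundedDistributiveLattice.Carrier L) (k : ℕ) → 1 ≤ k → k ≤ suc n →
    let open BoundedDistributiveLattice L in
    S L x (suc n) ≤-refl k ≈ (S L x n (n≤1+n n) k ∧ (S L x n (n≤1+n n) (pred k) ∨ x (fromℕ n)))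
proposition3p1 L n x k _ _ = S-adjoin-last L n x k
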